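{- For integers $r, n \geq 0$, let $E_n^{(r)}$ be the set of integers $k$ with $10^n \leq k < 10^{n+1}$ whose decimal representation contains the digit $9$ exactly $r$ times, and let $S_n^{(r)} := \sum_{k \in E_n^{(r)}} \frac{1}{k}$. For integers $r, n \geq 1$, define $$C_{n,r} := \frac{9}{10} S_{n-1}^{(r)} + \frac{1}{10} S_{n-1}^{(r-1)} - S_n^{(r)}.$$ Then $C_{n,r} \geq 0$ for all integers $r, n \geq 1$, and $$\sum_{r=1}^{\infty} \sum_{n=1}^{\infty} C_{n,r} < \infty.$$
   Context: Decimal representations of positive integers are taken without leading zeros. Sums over empty sets are $0$. -}

module Defs where

open import Data.Nat as ℕ using (ℕ; zero; suc; _^_; _∸_; _≡ᵇ_)
open import Data.Nat.DivMod using (_/_; _%_)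
open import Data.Bool using (if_then_else_)
open import Data.Integer using (+_)
open import Data.Rational as ℚ using (ℚ; 0ℚ; _+_; _*_; _-_)

-- number of occurrences of the digit 9 in the decimal representation of m,
-- computed with fuel (fuel = m suffices since m / 10 < m for m ≥ 1).
-- For m ≥ 1 this is the usual representation without leading zeros.
count9-fuel : ℕ → ℕ → ℕ
count9-fuel zero    _ = 0
count9-fuel (suc f) zero = 0
count9-fuel (suc f) (suc m) =
  (if (suc m % 10) ≡ᵇ 9 then 1 else 0) ℕ.+ count9-fuel f (suc m / 10)

count9 : ℕ → ℕ
count9 m = count9-fuel m m

-- 1/k as a rational (k = 0 gives 0; never used, since k ≥ 10^n ≥ 1)
inv : ℕ → ℚ
inv zero    = 0ℚ
inv (suc m) = (+ 1) ℚ./ suc m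

sumFrom : (ℕ → ℚ) → ℕ → ℕ → ℚ
sumFrom f a zero      = 0ℚ
sumFrom f a (suc len) = f a + sumFrom f (suc a) len

S : ℕ → ℕ → ℚ
S n r = sumFrom (λ k → if count9 k ≡ᵇ r then inv k else 0ℚ)
                (10 ^ n) (10 ^ suc n ∸ 10 ^ n)

C : ℕ → ℕ → ℚ
C n r = ((+ 9) ℚ./ 10) * S (n ∸ 1) r + ((+ 1) ℚ./ 10) * S (n ∸ 1) (r ∸ 1) - S n r

sum1 : (ℕ → ℚ) → ℕ → ℚ
sum1 f N = sumFrom f 1 N

module Submission where

-- Write c(k) for the number of nines in k and, for m ≥ 1, group the integers
-- of [10^n, 10^{n+1}) into the blocks {10m, …, 10m+9}, m ∈ [10^{n-1}, 10^n).
-- Appending a last digit d < 9 keeps c(m) and appending 9 raises it by one,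
-- so C_{n,r} = Σ_m Tblock(r, m) with, for r ≥ 1,
--   Tblock(r, m) = [c(m) = r]   (9/(10m) − Σ_{d<9} 1/(10m+d))
--           + [c(m) = r-1] (1/(10m) − 1/(10m+9)).
-- Each bracket lies between 0 and a multiple of gap(m) = 1/(10m) − 1/(10m+10),
-- which gives C_{n,r} ≥ 0 and Σ_r Tblock(r, m) ≤ 10 gap(m).  Summing over m the
-- gaps telescope, and summing the result over n telescopes again, so every
-- partial double sum is at most 10 · 1/10 = 1.
-- The file develops, in order: the digit recursion for count9, reciprocals,
-- finite sums (sumFrom), the block decomposition and bounds for Tblock, and the
-- reassembly of C_{n,r} and of the double sum.

open import Defs
open import Data.Nat using (ℕ; _≤_)
open import Data.Rational using (ℚ; 0ℚ) renaming (_≤_ to _≤ℚ_)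
open import Data.Product using (_×_; ∃; _,_; proj₁; proj₂)

open import Data.Bool using (Bool; true; false; if_then_else_; T)
open import Data.Unit using (tt)
open import Data.Nat as ℕ using (zero; suc; _<_; z≤n; s≤s; _∸_; _^_; _≡ᵇ_)
import Data.Nat.Properties as ℕP
open import Data.Nat.DivMod using (_/_; _%_; m/n<m; %-remove-+ˡ; +-distrib-/-∣ˡ; m*n/n≡m; m<n⇒m%n≡m; m<n⇒m/n≡0)
open import Data.Nat.Divisibility using (_∣_; divides)
open import Data.Nat.Coprimality using (1-coprimeTo)
open import Data.Integer as ℤ using (+_)
import Data.Integer.Properties as ℤP
open import Data.Rational as ℚ using (mkℚ; 1ℚ; _+_; _*_; _-_; *≤*)
open import Data.Rational.Properties
open import Data.Rational.Solver using (module +-*-Solver)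
open +-*-Solver
open import Relation.Nullary using (contradiction)
open import Relation.Binary.PropositionalEquality

δ : ℕ → ℕ
δ d = if d ≡ᵇ 9 then 1 else 0

δ-below-nine : ∀ {d} → d < 9 → δ d ≡ 0
δ-below-nine {d} d<9 with d ≡ᵇ 9 in is-nine
... | false = refl
... | true  = contradiction (ℕP.≡ᵇ⇒≡ d 9 (subst T (sym is-nine) tt)) (ℕP.<⇒≢ d<9)

-- Any fuel f ≥ m is enough for count9-fuel: each step divides m by 10.
count9-fuel-enough : ∀ f g m → m ≤ f → m ≤ g → count9-fuel f m ≡ count9-fuel g m
count9-fuel-enough zero    zero    zero    _         _         = refl
count9-fuel-enough zero    (suc g) zero    _         _         = refl
count9-fuel-enough (suc f) zero    zero    _         _         = refl
count9-fuel-enough (suc f) (suc g) zero    _         _         = refl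
count9-fuel-enough (suc f) (suc g) (suc m) (s≤s m≤f) (s≤s m≤g) =
  cong (δ (suc m % 10) ℕ.+_)
       (count9-fuel-enough f g (suc m / 10) (ℕP.≤-trans shrinks m≤f) (ℕP.≤-trans shrinks m≤g))
  where
  shrinks : suc m / 10 ≤ m
  shrinks = ℕP.≤-pred (m/n<m (suc m) 10 (s≤s (s≤s z≤n)))

count9-step : ∀ k → 1 ≤ k → count9 k ≡ δ (k % 10) ℕ.+ count9 (k / 10)
count9-step (suc k) _ =
  cong (δ (suc k % 10) ℕ.+_)
       (count9-fuel-enough k (suc k / 10) (suc k / 10)
         (ℕP.≤-pred (m/n<m (suc k) 10 (s≤s (s≤s z≤n)))) ℕP.≤-refl)

count9-append : ∀ m d → 1 ≤ m → d < 10 → count9 (10 ℕ.* m ℕ.+ d) ≡ δ d ℕ.+ count9 m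
count9-append m d 1≤m d<10 = begin
  count9 (10 ℕ.* m ℕ.+ d)
    ≡⟨ count9-step (10 ℕ.* m ℕ.+ d) positive ⟩
  δ ((10 ℕ.* m ℕ.+ d) % 10) ℕ.+ count9 ((10 ℕ.* m ℕ.+ d) / 10)
    ≡⟨ cong₂ (λ a b → δ a ℕ.+ count9 b) last-digit leading-part ⟩
  δ d ℕ.+ count9 m ∎
  where
  open ≡-Reasoning
  10∣10m : 10 ∣ 10 ℕ.* m
  10∣10m = divides m (ℕP.*-comm 10 m)
  positive : 1 ≤ 10 ℕ.* m ℕ.+ d
  positive = ℕP.≤-trans 1≤m (ℕP.≤-trans (ℕP.m≤n*m m 10) (ℕP.m≤m+n (10 ℕ.* m) d))
  last-digit : (10 ℕ.* m ℕ.+ d) % 10 ≡ d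
  last-digit = trans (%-remove-+ˡ d 10∣10m) (m<n⇒m%n≡m d<10)
  leading-part : (10 ℕ.* m ℕ.+ d) / 10 ≡ m
  leading-part = begin
    (10 ℕ.* m ℕ.+ d) / 10       ≡⟨ +-distrib-/-∣ˡ d 10∣10m ⟩
    10 ℕ.* m / 10 ℕ.+ d / 10    ≡⟨ cong₂ ℕ._+_ (cong (_/ 10) (ℕP.*-comm 10 m)) (m<n⇒m/n≡0 d<10) ⟩
    m ℕ.* 10 / 10 ℕ.+ 0         ≡⟨ ℕP.+-identityʳ _ ⟩
    m ℕ.* 10 / 10               ≡⟨ m*n/n≡m m 10 ⟩
    m                           ∎

count9-low-digit : ∀ m i → 1 ≤ m → 10 ℕ.* m ≤ i → i < 10 ℕ.* m ℕ.+ 9 → count9 i ≡ count9 m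
count9-low-digit m i 1≤m 10m≤i i<10m+9 = begin
  count9 i                                   ≡⟨ cong count9 (sym (ℕP.m+[n∸m]≡n 10m≤i)) ⟩
  count9 (10 ℕ.* m ℕ.+ d)                    ≡⟨ count9-append m d 1≤m (ℕP.m≤n⇒m≤1+n d<9) ⟩
  δ d ℕ.+ count9 m                           ≡⟨ cong (ℕ._+ count9 m) (δ-below-nine d<9) ⟩
  count9 m                                   ∎
  where
  open ≡-Reasoning
  d : ℕ
  d = i ∸ 10 ℕ.* m
  d<9 : d < 9
  d<9 = subst (d <_) (ℕP.m+n∸m≡n (10 ℕ.* m) 9) (ℕP.∸-monoˡ-< i<10m+9 10m≤i)

count9-digit-nine : ∀ m → 1 ≤ m → count9 (10 ℕ.* m ℕ.+ 9) ≡ suc (count9 m)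
count9-digit-nine m 1≤m = count9-append m 9 1≤m ℕP.≤-refl

-- inv (k+1) is already in normal form; this lets order facts on ℚ reduce to ℕ.
inv-suc : ∀ k → inv (suc k) ≡ mkℚ (+ 1) k (1-coprimeTo (suc k))
inv-suc k = normalize-coprime (1-coprimeTo (suc k))

inv-nonneg : ∀ a → 0ℚ ≤ℚ inv a
inv-nonneg zero    = ≤-refl
inv-nonneg (suc a) rewrite inv-suc a = *≤* (ℤ.+≤+ z≤n)

inv-antitone : ∀ {a b} → 1 ≤ a → a ≤ b → inv b ≤ℚ inv a
inv-antitone {suc a} {suc b} _ a≤b rewrite inv-suc a | inv-suc b =
  *≤* (subst₂ ℤ._≤_ (sym (ℤP.*-identityˡ _)) (sym (ℤP.*-identityˡ _)) (ℤ.+≤+ a≤b))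

inv-tenth : ∀ m → 1 ≤ m → ((+ 1) ℚ./ 10) * inv m ≡ inv (10 ℕ.* m)
inv-tenth (suc k) _ rewrite inv-suc k = refl

sub-nonneg : ∀ {p q} → q ≤ℚ p → 0ℚ ≤ℚ p - q
sub-nonneg {p} {q} q≤p = subst (_≤ℚ p - q) (+-inverseʳ q) (+-monoˡ-≤ (ℚ.- q) q≤p)

sub-mono : ∀ {p p′ q q′} → p ≤ℚ p′ → q′ ≤ℚ q → p - q ≤ℚ p′ - q′
sub-mono p≤p′ q′≤q = +-mono-≤ p≤p′ (neg-antimono-≤ q′≤q)

scale-nonneg : ∀ c .{{_ : ℚ.NonNegative c}} {x} → 0ℚ ≤ℚ x → 0ℚ ≤ℚ c * x
scale-nonneg c {x} 0≤x = subst (_≤ℚ c * x) (*-zeroʳ c) (*-monoˡ-≤-nonNeg c 0≤x)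

InRange : ℕ → ℕ → ℕ → Set
InRange a l i = a ≤ i × i < a ℕ.+ l

range-head : ∀ a l → InRange a (suc l) a
range-head a l = ℕP.≤-refl , ℕP.m<m+n a (s≤s z≤n)

range-tail : ∀ {a l i} → InRange (suc a) l i → InRange a (suc l) i
range-tail {a} {l} {i} (a<i , i<) = ℕP.<⇒≤ a<i , subst (i <_) (sym (ℕP.+-suc a l)) i<

sumFrom-cong : ∀ {f g : ℕ → ℚ} a l → (∀ i → InRange a l i → f i ≡ g i) → sumFrom f a l ≡ sumFrom g a l
sumFrom-cong a zero    _ = refl
sumFrom-cong a (suc l) h =
  cong₂ _+_ (h a (range-head a l)) (sumFrom-cong (suc a) l (λ i i∈ → h i (range-tail i∈)))

sumFrom-mono : ∀ {f g : ℕ → ℚ} a l → (∀ i → InRange a l i → f i ≤ℚ g i) → sumFrom f a l ≤ℚ sumFrom g a l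
sumFrom-mono a zero    _ = ≤-refl
sumFrom-mono a (suc l) h =
  +-mono-≤ (h a (range-head a l)) (sumFrom-mono (suc a) l (λ i i∈ → h i (range-tail i∈)))

sumFrom-zero : ∀ a l → sumFrom (λ _ → 0ℚ) a l ≡ 0ℚ
sumFrom-zero a zero    = refl
sumFrom-zero a (suc l) = cong (λ s → 0ℚ + s) (sumFrom-zero (suc a) l)

sumFrom-nonneg : ∀ {f : ℕ → ℚ} a l → (∀ i → InRange a l i → 0ℚ ≤ℚ f i) → 0ℚ ≤ℚ sumFrom f a l
sumFrom-nonneg {f} a l h = subst (_≤ℚ sumFrom f a l) (sumFrom-zero a l) (sumFrom-mono a l h)

sumFrom-+ : ∀ (f g : ℕ → ℚ) a l → sumFrom (λ i → f i + g i) a l ≡ sumFrom f a l + sumFrom g a l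
sumFrom-+ f g a zero    = refl
sumFrom-+ f g a (suc l) rewrite sumFrom-+ f g (suc a) l =
  solve 4 (λ x y u v → (x :+ y) :+ (u :+ v) := (x :+ u) :+ (y :+ v)) refl
    (f a) (g a) (sumFrom f (suc a) l) (sumFrom g (suc a) l)

sumFrom-- : ∀ (f g : ℕ → ℚ) a l → sumFrom (λ i → f i - g i) a l ≡ sumFrom f a l - sumFrom g a l
sumFrom-- f g a zero    = refl
sumFrom-- f g a (suc l) rewrite sumFrom-- f g (suc a) l =
  solve 4 (λ x y u v → (x :- y) :+ (u :- v) := (x :+ u) :- (y :+ v)) refl
    (f a) (g a) (sumFrom f (suc a) l) (sumFrom g (suc a) l)

sumFrom-* : ∀ c (f : ℕ → ℚ) a l → sumFrom (λ i → c * f i) a l ≡ c * sumFrom f a l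
sumFrom-* c f a zero    = sym (*-zeroʳ c)
sumFrom-* c f a (suc l) rewrite sumFrom-* c f (suc a) l = sym (*-distribˡ-+ c (f a) (sumFrom f (suc a) l))

sumFrom-swap : ∀ (F : ℕ → ℕ → ℚ) a k b l →
  sumFrom (λ i → sumFrom (F i) b l) a k ≡ sumFrom (λ j → sumFrom (λ i → F i j) a k) b l
sumFrom-swap F a zero    b l = sym (sumFrom-zero b l)
sumFrom-swap F a (suc k) b l rewrite sumFrom-swap F (suc a) k b l =
  sym (sumFrom-+ (F a) (λ j → sumFrom (λ i → F i j) (suc a) k) b l)

sumFrom-split : ∀ (f : ℕ → ℚ) a k l → sumFrom f a (k ℕ.+ l) ≡ sumFrom f a k + sumFrom f (a ℕ.+ k) l
sumFrom-split f a zero    l rewrite ℕP.+-identityʳ a = sym (+-identityˡ _)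
sumFrom-split f a (suc k) l rewrite sumFrom-split f (suc a) k l | ℕP.+-suc a k =
  sym (+-assoc (f a) (sumFrom f (suc a) k) (sumFrom f (suc a ℕ.+ k) l))

sumFrom-tens : ∀ (f : ℕ → ℚ) a l → sumFrom f (10 ℕ.* a) (10 ℕ.* l) ≡ sumFrom (λ m → sumFrom f (10 ℕ.* m) 10) a l
sumFrom-tens f a zero    rewrite ℕP.*-zeroʳ 10 = refl
sumFrom-tens f a (suc l) = begin
  sumFrom f (10 ℕ.* a) (10 ℕ.* suc l)
    ≡⟨ cong (sumFrom f (10 ℕ.* a)) (ℕP.*-suc 10 l) ⟩
  sumFrom f (10 ℕ.* a) (10 ℕ.+ 10 ℕ.* l)
    ≡⟨ sumFrom-split f (10 ℕ.* a) 10 (10 ℕ.* l) ⟩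
  sumFrom f (10 ℕ.* a) 10 + sumFrom f (10 ℕ.* a ℕ.+ 10) (10 ℕ.* l)
    ≡⟨ cong (λ b → sumFrom f (10 ℕ.* a) 10 + sumFrom f b (10 ℕ.* l)) next-block ⟩
  sumFrom f (10 ℕ.* a) 10 + sumFrom f (10 ℕ.* suc a) (10 ℕ.* l)
    ≡⟨ cong (λ s → sumFrom f (10 ℕ.* a) 10 + s) (sumFrom-tens f (suc a) l) ⟩
  sumFrom (λ m → sumFrom f (10 ℕ.* m) 10) a (suc l) ∎
  where
  open ≡-Reasoning
  next-block : 10 ℕ.* a ℕ.+ 10 ≡ 10 ℕ.* suc a
  next-block = trans (ℕP.+-comm (10 ℕ.* a) 10) (sym (ℕP.*-suc 10 a))

telescope : ∀ (φ : ℕ → ℚ) a l → sumFrom (λ i → φ i - φ (suc i)) a l ≡ φ a - φ (a ℕ.+ l)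
telescope φ a zero    rewrite ℕP.+-identityʳ a = sym (+-inverseʳ (φ a))
telescope φ a (suc l) rewrite telescope φ (suc a) l | ℕP.+-suc a l =
  solve 3 (λ x y z → (x :- y) :+ (y :- z) := x :- z) refl (φ a) (φ (suc a)) (φ (suc a ℕ.+ l))

9ℚ 10ℚ : ℚ
9ℚ = (+ 9) ℚ./ 1
10ℚ = (+ 10) ℚ./ 1

nine-copies : ∀ c a → sumFrom (λ _ → c) a 9 ≡ 9ℚ * c
nine-copies c a = solve 1 (λ x → x :+ (x :+ (x :+ (x :+ (x :+ (x :+ (x :+ (x :+ (x :+ con 0ℚ))))))))
                                 := con 9ℚ :* x) refl c

when : Bool → ℚ → ℚ
when b x = if b then x else 0ℚ

when-bounds : ∀ b {x y} → 0ℚ ≤ℚ x → x ≤ℚ y → (0ℚ ≤ℚ when b x) × (when b x ≤ℚ when b y)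
when-bounds true  0≤x x≤y = 0≤x , x≤y
when-bounds false _   _   = ≤-refl , ≤-refl

sumFrom-when : ∀ b (f : ℕ → ℚ) a l → sumFrom (λ i → when b (f i)) a l ≡ when b (sumFrom f a l)
sumFrom-when true  f a l = refl
sumFrom-when false f a l = sumFrom-zero a l

-- The indicator [c = r] is met by at most one r, so summing it over r costs at most u.
indicator-miss : ∀ c u a R → c < a → sumFrom (λ r → when (c ≡ᵇ r) u) a R ≡ 0ℚ
indicator-miss c u a zero    _   = refl
indicator-miss c u a (suc R) c<a with c ≡ᵇ a in is-a
... | true  = contradiction (ℕP.≡ᵇ⇒≡ c a (subst T (sym is-a) tt)) (ℕP.<⇒≢ c<a)
... | false = trans (+-identityˡ _) (indicator-miss c u (suc a) R (ℕP.m≤n⇒m≤1+n c<a))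

indicator-sum : ∀ c u a R → 0ℚ ≤ℚ u → sumFrom (λ r → when (c ≡ᵇ r) u) a R ≤ℚ u
indicator-sum c u a zero    0≤u = 0≤u
indicator-sum c u a (suc R) 0≤u with c ≡ᵇ a in is-a
... | true  rewrite indicator-miss c u (suc a) R
                      (s≤s (ℕP.≤-reflexive (ℕP.≡ᵇ⇒≡ c a (subst T (sym is-a) tt)))) = ≤-reflexive (+-identityʳ u)
... | false = subst (_≤ℚ u) (sym (+-identityˡ _)) (indicator-sum c u (suc a) R 0≤u)

term : ℕ → ℕ → ℚ
term r k = when (count9 k ≡ᵇ r) (inv k)

block-sum : ∀ m r′ → 1 ≤ m →
  sumFrom (term (suc r′)) (10 ℕ.* m) 10
    ≡ when (count9 m ≡ᵇ suc r′) (sumFrom inv (10 ℕ.* m) 9) + when (count9 m ≡ᵇ r′) (inv (10 ℕ.* m ℕ.+ 9))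
block-sum m r′ 1≤m = begin
  sumFrom (term r) (10 ℕ.* m) 10
    ≡⟨ sumFrom-split (term r) (10 ℕ.* m) 9 1 ⟩
  sumFrom (term r) (10 ℕ.* m) 9 + (term r (10 ℕ.* m ℕ.+ 9) + 0ℚ)
    ≡⟨ cong₂ _+_ low-digits (trans (+-identityʳ _) digit-nine) ⟩
  when (count9 m ≡ᵇ r) (sumFrom inv (10 ℕ.* m) 9) + when (count9 m ≡ᵇ r′) (inv (10 ℕ.* m ℕ.+ 9)) ∎
  where
  open ≡-Reasoning
  r : ℕ
  r = suc r′
  low-digits : sumFrom (term r) (10 ℕ.* m) 9 ≡ when (count9 m ≡ᵇ r) (sumFrom inv (10 ℕ.* m) 9)
  low-digits = trans
    (sumFrom-cong (10 ℕ.* m) 9 (λ i (lo , hi) →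
      cong (λ c → when (c ≡ᵇ r) (inv i)) (count9-low-digit m i 1≤m lo hi)))
    (sumFrom-when (count9 m ≡ᵇ r) inv (10 ℕ.* m) 9)
  digit-nine : term r (10 ℕ.* m ℕ.+ 9) ≡ when (count9 m ≡ᵇ r′) (inv (10 ℕ.* m ℕ.+ 9))
  digit-nine = cong (λ c → when (c ≡ᵇ r) (inv (10 ℕ.* m ℕ.+ 9))) (count9-digit-nine m 1≤m)

-- The contribution of the block with leading part m to C n r.
Tblock : ℕ → ℕ → ℚ
Tblock r m = ((+ 9) ℚ./ 10) * term r m + ((+ 1) ℚ./ 10) * term (r ∸ 1) m - sumFrom (term r) (10 ℕ.* m) 10

inv10 : ℕ → ℚ
inv10 m = inv (10 ℕ.* m)

gap : ℕ → ℚ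
gap m = inv10 m - inv10 (suc m)

low-deficit nine-deficit : ℕ → ℚ
low-deficit m  = 9ℚ * inv10 m - sumFrom inv (10 ℕ.* m) 9
nine-deficit m = inv10 m - inv (10 ℕ.* m ℕ.+ 9)

when-combine : ∀ b b′ x p q s t →
  p * when b x + q * when b′ x - (when b s + when b′ t) ≡ when b (p * x - s) + when b′ (q * x - t)
when-combine true  true  x p q s t =
  solve 5 (λ x p q s t → p :* x :+ q :* x :- (s :+ t) := (p :* x :- s) :+ (q :* x :- t)) refl x p q s t
when-combine true  false x p q s t =
  solve 4 (λ x p q s → p :* x :+ q :* con 0ℚ :- (s :+ con 0ℚ) := (p :* x :- s) :+ con 0ℚ) refl x p q s
when-combine false true  x p q s t =
  solve 4 (λ x p q t → p :* con 0ℚ :+ q :* x :- (con 0ℚ :+ t) := con 0ℚ :+ (q :* x :- t)) refl x p q t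
when-combine false false x p q s t =
  solve 2 (λ p q → p :* con 0ℚ :+ q :* con 0ℚ :- (con 0ℚ :+ con 0ℚ) := con 0ℚ :+ con 0ℚ) refl p q

Tblock-split : ∀ m r′ → 1 ≤ m →
  Tblock (suc r′) m ≡ when (count9 m ≡ᵇ suc r′) (low-deficit m) + when (count9 m ≡ᵇ r′) (nine-deficit m)
Tblock-split m r′ 1≤m = begin
  Tblock (suc r′) m
    ≡⟨ cong (λ s → ((+ 9) ℚ./ 10) * term (suc r′) m + ((+ 1) ℚ./ 10) * term r′ m - s) (block-sum m r′ 1≤m) ⟩
  ((+ 9) ℚ./ 10) * when b (inv m) + ((+ 1) ℚ./ 10) * when b′ (inv m)
    - (when b (sumFrom inv (10 ℕ.* m) 9) + when b′ (inv (10 ℕ.* m ℕ.+ 9)))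
    ≡⟨ when-combine b b′ (inv m) ((+ 9) ℚ./ 10) ((+ 1) ℚ./ 10) (sumFrom inv (10 ℕ.* m) 9) (inv (10 ℕ.* m ℕ.+ 9)) ⟩
  when b (((+ 9) ℚ./ 10) * inv m - sumFrom inv (10 ℕ.* m) 9) + when b′ (((+ 1) ℚ./ 10) * inv m - inv (10 ℕ.* m ℕ.+ 9))
    ≡⟨ cong₂ (λ x y → when b (x - sumFrom inv (10 ℕ.* m) 9) + when b′ (y - inv (10 ℕ.* m ℕ.+ 9))) nine-tenths tenth ⟩
  when b (low-deficit m) + when b′ (nine-deficit m) ∎
  where
  open ≡-Reasoning
  b b′ : Bool
  b  = count9 m ≡ᵇ suc r′
  b′ = count9 m ≡ᵇ r′
  tenth : ((+ 1) ℚ./ 10) * inv m ≡ inv10 m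
  tenth = inv-tenth m 1≤m
  nine-tenths : ((+ 9) ℚ./ 10) * inv m ≡ 9ℚ * inv10 m
  nine-tenths = trans (*-assoc 9ℚ ((+ 1) ℚ./ 10) (inv m)) (cong (9ℚ *_) tenth)

inv-in-block : ∀ m i → 1 ≤ m → 10 ℕ.* m ≤ i → i ≤ 10 ℕ.* m ℕ.+ 9 →
  (inv10 (suc m) ≤ℚ inv i) × (inv i ≤ℚ inv10 m)
inv-in-block m i 1≤m 10m≤i i≤10m+9 =
  inv-antitone 1≤i (ℕP.≤-trans i≤10m+9 block-end) , inv-antitone 1≤10m 10m≤i
  where
  1≤10m : 1 ≤ 10 ℕ.* m
  1≤10m = ℕP.≤-trans 1≤m (ℕP.m≤n*m m 10)
  1≤i : 1 ≤ i
  1≤i = ℕP.≤-trans 1≤10m 10m≤i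
  block-end : 10 ℕ.* m ℕ.+ 9 ≤ 10 ℕ.* suc m
  block-end = subst (10 ℕ.* m ℕ.+ 9 ≤_) (trans (ℕP.+-comm (10 ℕ.* m) 10) (sym (ℕP.*-suc 10 m)))
                    (ℕP.+-monoʳ-≤ (10 ℕ.* m) (ℕP.n≤1+n 9))

gap-nonneg : ∀ m → 1 ≤ m → 0ℚ ≤ℚ gap m
gap-nonneg m 1≤m = sub-nonneg (proj₁ (inv-in-block m (10 ℕ.* m) 1≤m ℕP.≤-refl (ℕP.m≤m+n _ 9)))

-- The nine low-digit reciprocals lie between 9 inv10 (m+1) and 9 inv10 m, hence
-- 0 ≤ low-deficit m ≤ 9 gap m; likewise 0 ≤ nine-deficit m ≤ gap m.
low-deficit-bounds : ∀ m → 1 ≤ m → (0ℚ ≤ℚ low-deficit m) × (low-deficit m ≤ℚ 9ℚ * gap m)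
low-deficit-bounds m 1≤m = sub-nonneg at-most , subst (low-deficit m ≤ℚ_) nine-gaps (sub-mono (≤-refl {9ℚ * inv10 m}) at-least)
  where
  bounds : ∀ i → InRange (10 ℕ.* m) 9 i → (inv10 (suc m) ≤ℚ inv i) × (inv i ≤ℚ inv10 m)
  bounds i (lo , hi) = inv-in-block m i 1≤m lo (ℕP.<⇒≤ hi)
  at-most : sumFrom inv (10 ℕ.* m) 9 ≤ℚ 9ℚ * inv10 m
  at-most = subst (sumFrom inv (10 ℕ.* m) 9 ≤ℚ_) (nine-copies (inv10 m) (10 ℕ.* m))
                  (sumFrom-mono (10 ℕ.* m) 9 (λ i i∈ → proj₂ (bounds i i∈)))
  at-least : 9ℚ * inv10 (suc m) ≤ℚ sumFrom inv (10 ℕ.* m) 9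
  at-least = subst (_≤ℚ sumFrom inv (10 ℕ.* m) 9) (nine-copies (inv10 (suc m)) (10 ℕ.* m))
                   (sumFrom-mono (10 ℕ.* m) 9 (λ i i∈ → proj₁ (bounds i i∈)))
  nine-gaps : 9ℚ * inv10 m - 9ℚ * inv10 (suc m) ≡ 9ℚ * gap m
  nine-gaps = solve 2 (λ x y → con 9ℚ :* x :- con 9ℚ :* y := con 9ℚ :* (x :- y)) refl (inv10 m) (inv10 (suc m))

nine-deficit-bounds : ∀ m → 1 ≤ m → (0ℚ ≤ℚ nine-deficit m) × (nine-deficit m ≤ℚ gap m)
nine-deficit-bounds m 1≤m = sub-nonneg (proj₂ bounds) , sub-mono (≤-refl {inv10 m}) (proj₁ bounds)
  where
  bounds : (inv10 (suc m) ≤ℚ inv (10 ℕ.* m ℕ.+ 9)) × (inv (10 ℕ.* m ℕ.+ 9) ≤ℚ inv10 m)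
  bounds = inv-in-block m (10 ℕ.* m ℕ.+ 9) 1≤m (ℕP.m≤m+n _ 9) ℕP.≤-refl

Tblock-bounds : ∀ m r → 1 ≤ m → 1 ≤ r →
  (0ℚ ≤ℚ Tblock r m)
    × (Tblock r m ≤ℚ when (count9 m ≡ᵇ r) (9ℚ * gap m) + when (suc (count9 m) ≡ᵇ r) (gap m))
Tblock-bounds m (suc r′) 1≤m _ =
  subst (0ℚ ≤ℚ_) (sym split) (subst (_≤ℚ when b (low-deficit m) + when b′ (nine-deficit m)) (+-identityˡ 0ℚ) (+-mono-≤ (proj₁ low) (proj₁ nine))) ,
  subst (_≤ℚ when b (9ℚ * gap m) + when b′ (gap m)) (sym split) (+-mono-≤ (proj₂ low) (proj₂ nine))
  where
  b b′ : Bool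
  b  = count9 m ≡ᵇ suc r′
  b′ = count9 m ≡ᵇ r′
  split : Tblock (suc r′) m ≡ when b (low-deficit m) + when b′ (nine-deficit m)
  split = Tblock-split m r′ 1≤m
  low : (0ℚ ≤ℚ when b (low-deficit m)) × (when b (low-deficit m) ≤ℚ when b (9ℚ * gap m))
  low = when-bounds b (proj₁ (low-deficit-bounds m 1≤m)) (proj₂ (low-deficit-bounds m 1≤m))
  nine : (0ℚ ≤ℚ when b′ (nine-deficit m)) × (when b′ (nine-deficit m) ≤ℚ when b′ (gap m))
  nine = when-bounds b′ (proj₁ (nine-deficit-bounds m 1≤m)) (proj₂ (nine-deficit-bounds m 1≤m))

block-total : ∀ m R → 1 ≤ m → sumFrom (λ r → Tblock r m) 1 R ≤ℚ 10ℚ * gap m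
block-total m R 1≤m = begin
  sumFrom (λ r → Tblock r m) 1 R
    ≤⟨ sumFrom-mono 1 R (λ r (1≤r , _) → proj₂ (Tblock-bounds m r 1≤m 1≤r)) ⟩
  sumFrom (λ r → when (c ≡ᵇ r) (9ℚ * g) + when (suc c ≡ᵇ r) g) 1 R
    ≡⟨ sumFrom-+ (λ r → when (c ≡ᵇ r) (9ℚ * g)) (λ r → when (suc c ≡ᵇ r) g) 1 R ⟩
  sumFrom (λ r → when (c ≡ᵇ r) (9ℚ * g)) 1 R + sumFrom (λ r → when (suc c ≡ᵇ r) g) 1 R
    ≤⟨ +-mono-≤ (indicator-sum c (9ℚ * g) 1 R (scale-nonneg 9ℚ 0≤g)) (indicator-sum (suc c) g 1 R 0≤g) ⟩
  9ℚ * g + g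
    ≡⟨ solve 1 (λ x → con 9ℚ :* x :+ x := con 10ℚ :* x) refl g ⟩
  10ℚ * g ∎
  where
  open ≤-Reasoning
  c : ℕ
  c = count9 m
  g : ℚ
  g = gap m
  0≤g : 0ℚ ≤ℚ g
  0≤g = gap-nonneg m 1≤m

-- Number of leading parts m ∈ [10^p, 10^{p+1}).
width : ℕ → ℕ
width p = 10 ^ suc p ∸ 10 ^ p

C-blocks : ∀ p r → C (suc p) r ≡ sumFrom (λ m → Tblock r m) (10 ^ p) (width p)
C-blocks p r = sym (begin
  sumFrom (λ m → Tblock r m) a (width p)
    ≡⟨ sumFrom-- (λ m → c9 * term r m + c1 * term (r ∸ 1) m) (λ m → sumFrom (term r) (10 ℕ.* m) 10) a (width p) ⟩
  sumFrom (λ m → c9 * term r m + c1 * term (r ∸ 1) m) a (width p) - sumFrom (λ m → sumFrom (term r) (10 ℕ.* m) 10) a (width p)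
    ≡⟨ cong₂ _-_ (trans (sumFrom-+ (λ m → c9 * term r m) (λ m → c1 * term (r ∸ 1) m) a (width p))
                        (cong₂ _+_ (sumFrom-* c9 (term r) a (width p)) (sumFrom-* c1 (term (r ∸ 1)) a (width p))))
                 (sym regroup) ⟩
  C (suc p) r ∎)
  where
  open ≡-Reasoning
  a : ℕ
  a = 10 ^ p
  c9 c1 : ℚ
  c9 = (+ 9) ℚ./ 10
  c1 = (+ 1) ℚ./ 10
  regroup : S (suc p) r ≡ sumFrom (λ m → sumFrom (term r) (10 ℕ.* m) 10) a (width p)
  regroup = trans (cong (sumFrom (term r) (10 ℕ.* a)) (sym (ℕP.*-distribˡ-∸ 10 (10 ^ suc p) (10 ^ p))))
                  (sumFrom-tens (term r) a (width p))

C-nonneg : ∀ n r → 1 ≤ n → 1 ≤ r → 0ℚ ≤ℚ C n r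
C-nonneg (suc p) r _ 1≤r = subst (0ℚ ≤ℚ_) (sym (C-blocks p r))
  (sumFrom-nonneg (10 ^ p) (width p) (λ m (10^p≤m , _) →
    proj₁ (Tblock-bounds m r (ℕP.≤-trans (ℕP.m^n>0 10 p) 10^p≤m) 1≤r)))

-- ψ n = 1/10^n; the row sums Σ_r C n r are bounded by 10 (ψ n − ψ (n+1)).
ψ : ℕ → ℚ
ψ n = inv10 (10 ^ (n ∸ 1))

row-bound : ∀ n R → 1 ≤ n → sumFrom (λ r → C n r) 1 R ≤ℚ 10ℚ * (ψ n - ψ (suc n))
row-bound (suc p) R _ = begin
  sumFrom (λ r → C (suc p) r) 1 R
    ≡⟨ sumFrom-cong 1 R (λ r _ → C-blocks p r) ⟩
  sumFrom (λ r → sumFrom (λ m → Tblock r m) a (width p)) 1 R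
    ≡⟨ sumFrom-swap Tblock 1 R a (width p) ⟩
  sumFrom (λ m → sumFrom (λ r → Tblock r m) 1 R) a (width p)
    ≤⟨ sumFrom-mono a (width p) (λ m (a≤m , _) → block-total m R (ℕP.≤-trans (ℕP.m^n>0 10 p) a≤m)) ⟩
  sumFrom (λ m → 10ℚ * gap m) a (width p)
    ≡⟨ trans (sumFrom-* 10ℚ gap a (width p)) (cong (10ℚ *_) (telescope inv10 a (width p))) ⟩
  10ℚ * (inv10 a - inv10 (a ℕ.+ width p))
    ≡⟨ cong (λ b → 10ℚ * (inv10 a - inv10 b)) (ℕP.m+[n∸m]≡n (ℕP.^-monoʳ-≤ 10 (ℕP.n≤1+n p))) ⟩
  10ℚ * (ψ (suc p) - ψ (suc (suc p))) ∎
  where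
  open ≤-Reasoning
  a : ℕ
  a = 10 ^ p

-- Second half: the rows telescope in n, so every partial double sum is at most 10 ψ 1 = 1.
double-sum-bound : ∀ R N → sum1 (λ r → sum1 (λ n → C n r) N) R ≤ℚ 1ℚ
double-sum-bound R N = begin
  sumFrom (λ r → sumFrom (λ n → C n r) 1 N) 1 R
    ≡⟨ sumFrom-swap (λ r n → C n r) 1 R 1 N ⟩
  sumFrom (λ n → sumFrom (λ r → C n r) 1 R) 1 N
    ≤⟨ sumFrom-mono 1 N (λ n (1≤n , _) → row-bound n R 1≤n) ⟩
  sumFrom (λ n → 10ℚ * (ψ n - ψ (suc n))) 1 N
    ≡⟨ trans (sumFrom-* 10ℚ (λ n → ψ n - ψ (suc n)) 1 N) (cong (10ℚ *_) (telescope ψ 1 N)) ⟩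
  10ℚ * (ψ 1 - ψ (1 ℕ.+ N))
    ≤⟨ *-monoˡ-≤-nonNeg 10ℚ (sub-mono (≤-refl {ψ 1}) (inv-nonneg (10 ℕ.* 10 ^ N))) ⟩
  10ℚ * (ψ 1 - 0ℚ)
    ≡⟨⟩
  1ℚ ∎
  where open ≤-Reasoning

proposition1 : ((n r : ℕ) → 1 ≤ n → 1 ≤ r → 0ℚ ≤ℚ C n r)
    × ∃ (λ (B : ℚ) → (R N : ℕ) → sum1 (λ r → sum1 (λ n → C n r) N) R ≤ℚ B)
proposition1 = C-nonneg , (1ℚ , double-sum-bound)
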